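{- Let $X$ be a finite non-empty set and $R$ a monotone transit function on $X$. Then $R$ satisfies (w) if and only if it satisfies both (mm) and (x'), where: (w) for all $x,y,z\in X$: $z\in R(x,y)$ or $y\in R(x,z)$ or $x\in R(y,z)$; (mm) for all $x,y,u,v\in X$: if $R(x,y)\cap R(u,v)\neq\emptyset$ then there are $p,q\in R(x,y)\cup R(u,v)$ with $R(x,y)\cup R(u,v)\subseteq R(p,q)$; (x') for all $x,y,z\in X$: if $z\notin R(x,y)$ then $R(x,y)\subseteq R(x,z)\cup R(z,y)$.
   Context: A transit function on a finite non-empty set $X$ is a map $R:X\times X\to 2^X$ such that for all $u,v\in X$: $u\in R(u,v)$, $R(u,v)=R(v,u)$, and $R(u,u)=\{u\}$. $R$ is monotone if for all $u,v,p,q\in X$, $p,q\in R(u,v)$ implies $R(p,q)\subseteq R(u,v)$. -}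

module Defs where

open import Data.Nat using (ℕ; suc)
open import Data.Fin using (Fin)
open import Data.Fin.Subset using (Subset; _∈_; _∉_; _⊆_; _∩_; _∪_; ⁅_⁆; Nonempty)
open import Data.Product using (_×_; ∃; ∃-syntax; _,_)
open import Data.Sum using (_⊎_)
open import Relation.Binary.PropositionalEquality using (_≡_)

-- A finite non-empty set X is modelled as Fin n with n ≥ 1 (n = suc m).
-- A transit function: R : X → X → 2^X, with 2^X = Subset n.

IsTransit : {n : ℕ} → (Fin n → Fin n → Subset n) → Set
IsTransit {n} R =
  ((u v : Fin n) → u ∈ R u v) ×
  ((u v : Fin n) → R u v ≡ R v u) ×
  ((u : Fin n) → R u u ≡ ⁅ u ⁆)

IsMonotone : {n : ℕ} → (Fin n → Fin n → Subset n) → Set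
IsMonotone {n} R =
  (u v p q : Fin n) → p ∈ R u v → q ∈ R u v → R p q ⊆ R u v

AxiomW : {n : ℕ} → (Fin n → Fin n → Subset n) → Set
AxiomW {n} R =
  (x y z : Fin n) → z ∈ R x y ⊎ (y ∈ R x z ⊎ x ∈ R y z)

AxiomMM : {n : ℕ} → (Fin n → Fin n → Subset n) → Set
AxiomMM {n} R =
  (x y u v : Fin n) → Nonempty (R x y ∩ R u v) →
  ∃[ p ] ∃[ q ] (p ∈ (R x y ∪ R u v) × q ∈ (R x y ∪ R u v) ×
                 (R x y ∪ R u v) ⊆ R p q)

AxiomX' : {n : ℕ} → (Fin n → Fin n → Subset n) → Set
AxiomX' {n} R =
  (x y z : Fin n) → z ∉ R x y → R x y ⊆ (R x z ∪ R z y)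

{-# OPTIONS --safe #-}
module Submission where

-- Axiom (w) says that of any three points one lies in the interval of the other two.
-- With monotonicity this lets an interval R(a,b) be enlarged, with new endpoints
-- among a, b, c, until it absorbs c; this gives (x'), and absorbing u and v into
-- R(x,y) gives (mm). Conversely, let z ∉ R(x,y) and y ∉ R(x,z). The intervals
-- R(x,y) and R(x,z) meet in x, so (mm) yields R(p,q) containing both; by
-- monotonicity p and q cannot lie in the same one of them, and two applications
-- of (x') then give p ∈ R(z,y) and q ∈ R(p,z), whence x ∈ R(p,q) ⊆ R(p,z) ⊆ R(z,y).

open import Defs
open import Data.Nat using (ℕ; suc)
open import Data.Fin using (Fin)
open import Data.Fin.Subset using (Subset; _∈_; _∉_; _⊆_; _∪_)
open import Data.Fin.Subset.Properties using (_∈?_; p⊆p∪q; q⊆p∪q; x∈p∪q⁻; x∈p∩q⁺; ⊆-refl; ⊆-trans)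
open import Data.Product using (_×_; _,_; ∃-syntax)
open import Data.Sum using (inj₁; inj₂; [_,_])
open import Function using (id; _∘_)
open import Function.Bundles using (_⇔_; mk⇔)
open import Relation.Nullary using (yes; no; contradiction)
open import Relation.Binary.PropositionalEquality using (_≡_; subst)

∪-least : ∀ {n} {p q r : Subset n} → p ⊆ r → q ⊆ r → p ∪ q ⊆ r
∪-least {p = p} {q} p⊆r q⊆r x∈p∪q = [ p⊆r , q⊆r ] (x∈p∪q⁻ p q x∈p∪q)

x∈p∪q∧x∉p⇒x∈q : ∀ {n} {x : Fin n} (p q : Subset n) → x ∈ p ∪ q → x ∉ p → x ∈ q
x∈p∪q∧x∉p⇒x∈q p q x∈p∪q x∉p = [ (λ x∈p → contradiction x∈p x∉p) , id ] (x∈p∪q⁻ p q x∈p∪q)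

module Intervals {n : ℕ} (R : Fin n → Fin n → Subset n)
                 (left∈ : ∀ u v → u ∈ R u v)
                 (R-sym : ∀ u v → R u v ≡ R v u)
                 (monotone : IsMonotone R) where

  ∈-sym : ∀ {w} u v → w ∈ R u v → w ∈ R v u
  ∈-sym {w} u v = subst (w ∈_) (R-sym u v)

  right∈ : ∀ u v → v ∈ R u v
  right∈ u v = ∈-sym v u (left∈ v u)

  interval-⊆ : ∀ {u v p q} → p ∈ R u v → q ∈ R u v → R p q ⊆ R u v
  interval-⊆ {u} {v} {p} {q} = monotone u v p q

  w⇒x' : AxiomW R → AxiomX' R
  w⇒x' W x y z z∉Rxy with W x y z
  ... | inj₁ z∈Rxy = contradiction z∈Rxy z∉Rxy
  ... | inj₂ (inj₁ y∈Rxz) = p⊆p∪q (R z y) ∘ interval-⊆ (left∈ x z) y∈Rxz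
  ... | inj₂ (inj₂ x∈Ryz) = q⊆p∪q (R x z) (R z y) ∘ interval-⊆ (∈-sym y z x∈Ryz) (right∈ z y)

  w⇒enlarge-interval : AxiomW R → ∀ {S a b c} → a ∈ S → b ∈ S → c ∈ S →
    ∃[ a′ ] ∃[ b′ ] (a′ ∈ S × b′ ∈ S × R a b ⊆ R a′ b′ × c ∈ R a′ b′)
  w⇒enlarge-interval W {a = a} {b} {c} a∈S b∈S c∈S with W a b c
  ... | inj₁ c∈Rab = a , b , a∈S , b∈S , ⊆-refl , c∈Rab
  ... | inj₂ (inj₁ b∈Rac) = a , c , a∈S , c∈S , interval-⊆ (left∈ a c) b∈Rac , right∈ a c
  ... | inj₂ (inj₂ a∈Rbc) = b , c , b∈S , c∈S , interval-⊆ a∈Rbc (left∈ b c) , right∈ b c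

  w⇒common-interval : AxiomW R → ∀ {S x y u v} → x ∈ S → y ∈ S → u ∈ S → v ∈ S →
    ∃[ p ] ∃[ q ] (p ∈ S × q ∈ S × R x y ⊆ R p q × R u v ⊆ R p q)
  w⇒common-interval W x∈S y∈S u∈S v∈S =
    let a , b , a∈S , b∈S , Rxy⊆Rab , u∈Rab = w⇒enlarge-interval W x∈S y∈S u∈S
        p , q , p∈S , q∈S , Rab⊆Rpq , v∈Rpq = w⇒enlarge-interval W a∈S b∈S v∈S
    in p , q , p∈S , q∈S , ⊆-trans Rxy⊆Rab Rab⊆Rpq , interval-⊆ (Rab⊆Rpq u∈Rab) v∈Rpq

  w⇒mm : AxiomW R → AxiomMM R
  w⇒mm W x y u v _ =
    let p , q , p∈U , q∈U , Rxy⊆Rpq , Ruv⊆Rpq =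
          w⇒common-interval W (Rxy⊆U (left∈ x y)) (Rxy⊆U (right∈ x y))
                              (Ruv⊆U (left∈ u v)) (Ruv⊆U (right∈ u v))
    in p , q , p∈U , q∈U , ∪-least Rxy⊆Rpq Ruv⊆Rpq
    where
    Rxy⊆U : R x y ⊆ R x y ∪ R u v
    Rxy⊆U = p⊆p∪q (R u v)
    Ruv⊆U : R u v ⊆ R x y ∪ R u v
    Ruv⊆U = q⊆p∪q (R x y) (R u v)

  module _ (X' : AxiomX' R) {x y z : Fin n} (z∉Rxy : z ∉ R x y) (y∉Rxz : y ∉ R x z) where

    straddling-interval⇒x∈Rzy : ∀ {p q} → p ∈ R x y → q ∈ R x z →
      R x y ∪ R x z ⊆ R p q → x ∈ R z y
    straddling-interval⇒x∈Rzy {p} {q} p∈Rxy q∈Rxz U⊆Rpq =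
      interval-⊆ p∈Rzy (left∈ z y) (interval-⊆ (left∈ p z) q∈Rpz x∈Rpq)
      where
      x∈Rpq : x ∈ R p q
      x∈Rpq = U⊆Rpq (p⊆p∪q (R x z) (left∈ x y))
      y∈Rpq : y ∈ R p q
      y∈Rpq = U⊆Rpq (p⊆p∪q (R x z) (right∈ x y))
      z∈Rpq : z ∈ R p q
      z∈Rpq = U⊆Rpq (q⊆p∪q (R x y) (R x z) (right∈ x z))

      p∉Rxz : p ∉ R x z
      p∉Rxz p∈Rxz = y∉Rxz (interval-⊆ p∈Rxz q∈Rxz y∈Rpq)
      p∈Rzy : p ∈ R z y
      p∈Rzy = x∈p∪q∧x∉p⇒x∈q (R x z) (R z y) (X' x y z z∉Rxy p∈Rxy) p∉Rxz

      q∉Rxp : q ∉ R x p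
      q∉Rxp q∈Rxp = z∉Rxy (interval-⊆ p∈Rxy (interval-⊆ (left∈ x y) p∈Rxy q∈Rxp) z∈Rpq)
      q∈Rpz : q ∈ R p z
      q∈Rpz = x∈p∪q∧x∉p⇒x∈q (R x p) (R p z) (X' x z p p∉Rxz q∈Rxz) q∉Rxp

    mm⇒x∈Rzy : AxiomMM R → x ∈ R z y
    mm⇒x∈Rzy MM with MM x y x z (x , x∈p∩q⁺ (left∈ x y , left∈ x z))
    ... | p , q , p∈U , q∈U , U⊆Rpq with x∈p∪q⁻ (R x y) (R x z) p∈U | x∈p∪q⁻ (R x y) (R x z) q∈U
    ... | inj₁ p∈Rxy | inj₁ q∈Rxy =
      contradiction (interval-⊆ p∈Rxy q∈Rxy (U⊆Rpq (q⊆p∪q (R x y) (R x z) (right∈ x z)))) z∉Rxy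
    ... | inj₂ p∈Rxz | inj₂ q∈Rxz =
      contradiction (interval-⊆ p∈Rxz q∈Rxz (U⊆Rpq (p⊆p∪q (R x z) (right∈ x y)))) y∉Rxz
    ... | inj₁ p∈Rxy | inj₂ q∈Rxz = straddling-interval⇒x∈Rzy p∈Rxy q∈Rxz U⊆Rpq
    ... | inj₂ p∈Rxz | inj₁ q∈Rxy = straddling-interval⇒x∈Rzy q∈Rxy p∈Rxz (∈-sym p q ∘ U⊆Rpq)

  mm∧x'⇒w : AxiomMM R → AxiomX' R → AxiomW R
  mm∧x'⇒w MM X' x y z with z ∈? R x y | y ∈? R x z
  ... | yes z∈Rxy | _         = inj₁ z∈Rxy
  ... | no _      | yes y∈Rxz = inj₂ (inj₁ y∈Rxz)
  ... | no z∉Rxy  | no y∉Rxz  = inj₂ (inj₂ (∈-sym z y (mm⇒x∈Rzy X' z∉Rxy y∉Rxz MM)))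

theorem3 : (m : ℕ) (R : Fin (suc m) → Fin (suc m) → Subset (suc m)) →
    IsTransit R → IsMonotone R →
    (AxiomW R ⇔ (AxiomMM R × AxiomX' R))
theorem3 m R (left∈ , R-sym , _) monotone =
  mk⇔ (λ W → w⇒mm W , w⇒x' W) (λ (MM , X') → mm∧x'⇒w MM X')
  where open Intervals R left∈ R-sym monotone
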